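{- Let $(M,\leq,\sqsubseteq)$ be a mixed lattice. Then the statement "for all $x,y\in M$: $x\leq y \iff y\sqcup x=y \iff x\sqcap y=x$" is equivalent to the statement "for all $x,y\in M$: if $y\sqsubseteq x$ and $x\leq y$, then $x=y$".
   Context: Let $M$ be a set with two partial orderings $\leq$ and $\sqsubseteq$. For $x,y\in M$ the mixed upper envelope is $x\sqcup y=\min\{w\in M: x\sqsubseteq w \text{ and } y\leq w\}$ and the mixed lower envelope is $x\sqcap y=\max\{w\in M: w\sqsubseteq x\text{ and } w\leq y\}$, where the minimum and maximum are taken with respect to $\leq$. The triple $(M,\leq,\sqsubseteq)$ is called a mixed lattice if $x\sqcup y$ and $x\sqcap y$ exist in $M$ for all $x,y\in M$. -}

module Defs where

open import Level using (Level; _⊔_; suc)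
open import Relation.Binary.Core using (Rel)
open import Relation.Binary.Structures using (IsPartialOrder)
open import Relation.Binary.PropositionalEquality using (_≡_)
open import Data.Product using (_×_)

IsMinimumOf : ∀ {a ℓ p} {A : Set a} → Rel A ℓ → (A → Set p) → A → Set (a ⊔ ℓ ⊔ p)
IsMinimumOf _≤_ P w = P w × (∀ v → P v → w ≤ v)

IsMaximumOf : ∀ {a ℓ p} {A : Set a} → Rel A ℓ → (A → Set p) → A → Set (a ⊔ ℓ ⊔ p)
IsMaximumOf _≤_ P w = P w × (∀ v → P v → v ≤ w)

record MixedLattice (a ℓ₁ ℓ₂ : Level) : Set (suc (a ⊔ ℓ₁ ⊔ ℓ₂)) where
  field
    Carrier : Set a
    _≤_     : Rel Carrier ℓ₁
    _⊑_     : Rel Carrier ℓ₂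
    ≤-isPartialOrder : IsPartialOrder _≡_ _≤_
    ⊑-isPartialOrder : IsPartialOrder _≡_ _⊑_
    _⊔ₘ_ : Carrier → Carrier → Carrier
    _⊓ₘ_ : Carrier → Carrier → Carrier
    ⊔ₘ-isMin : ∀ x y → IsMinimumOf _≤_ (λ w → (x ⊑ w) × (y ≤ w)) (x ⊔ₘ y)
    ⊓ₘ-isMax : ∀ x y → IsMaximumOf _≤_ (λ w → (w ⊑ x) × (w ≤ y)) (x ⊓ₘ y)

-- Given mixed antisymmetry, x ≤ y forces y ⊔ₘ x = y because y itself is a
-- candidate for the envelope while y ⊑ y ⊔ₘ x ≤ y; dually x ⊓ₘ y = x. Conversely,
-- if y ⊑ x and x ≤ y then y is a candidate for x ⊓ₘ y, which equals x, so y ≤ x.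
module Submission where

open import Defs
open import Data.Product using (_×_; _,_; proj₁; proj₂)
open import Relation.Binary.PropositionalEquality using (_≡_; sym; subst)
open import Relation.Binary.Structures using (IsPartialOrder)
open import Function.Bundles using (_⇔_; mk⇔; Equivalence)

module MixedLatticeProperties {a ℓ₁ ℓ₂} (L : MixedLattice a ℓ₁ ℓ₂) where

  open MixedLattice L
  private
    module ≤ = IsPartialOrder ≤-isPartialOrder
    module ⊑ = IsPartialOrder ⊑-isPartialOrder

  ⊑-⊔ₘ : ∀ x y → x ⊑ (x ⊔ₘ y)
  ⊑-⊔ₘ x y = proj₁ (proj₁ (⊔ₘ-isMin x y))

  ≤-⊔ₘ : ∀ x y → y ≤ (x ⊔ₘ y)
  ≤-⊔ₘ x y = proj₂ (proj₁ (⊔ₘ-isMin x y))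

  ⊔ₘ-least : ∀ {x y w} → x ⊑ w → y ≤ w → (x ⊔ₘ y) ≤ w
  ⊔ₘ-least {x} {y} {w} x⊑w y≤w = proj₂ (⊔ₘ-isMin x y) w (x⊑w , y≤w)

  ⊓ₘ-⊑ : ∀ x y → (x ⊓ₘ y) ⊑ x
  ⊓ₘ-⊑ x y = proj₁ (proj₁ (⊓ₘ-isMax x y))

  ⊓ₘ-≤ : ∀ x y → (x ⊓ₘ y) ≤ y
  ⊓ₘ-≤ x y = proj₂ (proj₁ (⊓ₘ-isMax x y))

  ⊓ₘ-greatest : ∀ {x y w} → w ⊑ x → w ≤ y → w ≤ (x ⊓ₘ y)
  ⊓ₘ-greatest {x} {y} {w} w⊑x w≤y = proj₂ (⊓ₘ-isMax x y) w (w⊑x , w≤y)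

  ⊔ₘ≡⇒≤ : ∀ {x y} → y ⊔ₘ x ≡ y → x ≤ y
  ⊔ₘ≡⇒≤ {x} {y} e = subst (x ≤_) e (≤-⊔ₘ y x)

  ⊓ₘ≡⇒≤ : ∀ {x y} → x ⊓ₘ y ≡ x → x ≤ y
  ⊓ₘ≡⇒≤ {x} {y} e = subst (_≤ y) e (⊓ₘ-≤ x y)

  MixedAntisymmetric : Set _
  MixedAntisymmetric = ∀ x y → y ⊑ x → x ≤ y → x ≡ y

  Absorbing : Set _
  Absorbing = ∀ x y → ((x ≤ y) ⇔ (y ⊔ₘ x ≡ y)) × ((y ⊔ₘ x ≡ y) ⇔ (x ⊓ₘ y ≡ x))

  module _ (antisym : MixedAntisymmetric) where

    ≤⇒⊔ₘ≡ : ∀ {x y} → x ≤ y → y ⊔ₘ x ≡ y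
    ≤⇒⊔ₘ≡ {x} {y} x≤y = antisym (y ⊔ₘ x) y (⊑-⊔ₘ y x) (⊔ₘ-least ⊑.refl x≤y)

    ≤⇒⊓ₘ≡ : ∀ {x y} → x ≤ y → x ⊓ₘ y ≡ x
    ≤⇒⊓ₘ≡ {x} {y} x≤y = sym (antisym x (x ⊓ₘ y) (⊓ₘ-⊑ x y) (⊓ₘ-greatest ⊑.refl x≤y))

    mixedAntisymmetric⇒absorbing : Absorbing
    mixedAntisymmetric⇒absorbing x y =
        mk⇔ ≤⇒⊔ₘ≡ ⊔ₘ≡⇒≤
      , mk⇔ (λ e → ≤⇒⊓ₘ≡ (⊔ₘ≡⇒≤ e)) (λ e → ≤⇒⊔ₘ≡ (⊓ₘ≡⇒≤ e))

  absorbing⇒mixedAntisymmetric : Absorbing → MixedAntisymmetric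
  absorbing⇒mixedAntisymmetric absorb x y y⊑x x≤y = ≤.antisym x≤y y≤x
    where
    x⊓ₘy≡x : x ⊓ₘ y ≡ x
    x⊓ₘy≡x = Equivalence.to (proj₂ (absorb x y)) (Equivalence.to (proj₁ (absorb x y)) x≤y)

    y≤x : y ≤ x
    y≤x = subst (y ≤_) x⊓ₘy≡x (⊓ₘ-greatest y⊑x ≤.refl)

lemma2p4 : ∀ {a ℓ₁ ℓ₂} (L : MixedLattice a ℓ₁ ℓ₂) →
    let open MixedLattice L in
    (∀ x y → ((x ≤ y) ⇔ (y ⊔ₘ x ≡ y)) × ((y ⊔ₘ x ≡ y) ⇔ (x ⊓ₘ y ≡ x)))
    ⇔ (∀ x y → y ⊑ x → x ≤ y → x ≡ y)
lemma2p4 L = mk⇔ absorbing⇒mixedAntisymmetric mixedAntisymmetric⇒absorbing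
  where open MixedLatticeProperties L
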